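{- For any positive integer $L$ divisible by $4$, there exists a bipartite graph $G=(C\cup S,E)$ together with an ordering in which the clients of $C$ are inserted, such that $|C|=L^2$, $|S|=L$, $\mathrm{opt}(G)=L$, and any algorithm for maintaining an optimal assignment requires $\Omega(L^3)$ changes to the assignment over the insertion sequence.
   Context: An assignment $\mathcal A$ maps each client to a neighboring server; the load of a server is the number of clients assigned to it; $\ell(\mathcal A)$ is the maximum load and $\mathrm{opt}(G)$ the minimum of $\ell(\mathcal A)$ over all assignments. Maintaining an optimal assignment means: with $G_t$ the graph after $t$ client insertions (each client arriving with all its incident edges) and $\mathcal A_t$ the current assignment, $\ell(\mathcal A_t)=\mathrm{opt}(G_t)$ for all $t$. A change is the reassignment of one client. -}

module Defs where

open import Data.Nat using (ℕ; zero; suc; _+_; _≤_; _<_; _<?_; _⊔_)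
open import Data.Fin using (Fin; toℕ)
open import Data.Fin.Properties using (_≟_)
open import Data.List using (List; length; filter; map; foldr)
open import Data.List.Base using (sum)
open import Data.Fin.Base using ()
open import Data.Vec.Functional using ()
open import Data.List using (allFin)
open import Data.Bool using (Bool; T)
open import Data.Product using (Σ; _×_; _,_)
open import Relation.Nullary using (¬_)
open import Relation.Nullary.Decidable using (_×-dec_; ¬?)
open import Relation.Binary.PropositionalEquality using (_≡_)

-- Clients are inserted in the order
-- 0, 1, …, N-1, so the graph G_t after t insertions consists of the
-- clients i with toℕ i < t together with all their incident edges.
BipGraph : ℕ → ℕ → Set
BipGraph N M = Fin N → Fin M → Bool

-- An assignment: every client is mapped to a server.  In the graph G_t only
-- the clients i with toℕ i < t are relevant.
Assignment : ℕ → ℕ → Set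
Assignment N M = Fin N → Fin M

ValidAt : ∀ {N M} → BipGraph N M → ℕ → Assignment N M → Set
ValidAt G t A = ∀ i → toℕ i < t → T (G i (A i))

load : ∀ {N M} → Assignment N M → ℕ → Fin M → ℕ
load {N} A t s = length (filter (λ i → (toℕ i <? t) ×-dec (A i ≟ s)) (allFin N))

maxLoad : ∀ {N M} → Assignment N M → ℕ → ℕ
maxLoad {N} {M} A t = foldr _⊔_ 0 (map (load A t) (allFin M))

OptIs : ∀ {N M} → BipGraph N M → ℕ → ℕ → Set
OptIs {N} {M} G t k =
  Σ (Assignment N M) (λ A → ValidAt G t A × maxLoad A t ≡ k)
  × (∀ (B : Assignment N M) → ValidAt G t B → k ≤ maxLoad B t)

OptimalAt : ∀ {N M} → BipGraph N M → ℕ → Assignment N M → Set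
OptimalAt {N} {M} G t A =
  ValidAt G t A × (∀ (B : Assignment N M) → ValidAt G t B → maxLoad A t ≤ maxLoad B t)

AssignmentSeq : ℕ → ℕ → Set
AssignmentSeq N M = ℕ → Assignment N M

MaintainsOptimal : ∀ {N M} → BipGraph N M → AssignmentSeq N M → Set
MaintainsOptimal {N} G 𝒜 = ∀ t → t ≤ N → OptimalAt G t (𝒜 t)

-- Changes when going from 𝒜 t to 𝒜 (t+1): clients present before the
-- (t+1)-st insertion that are reassigned (the new client's initial
-- assignment is not a change).
changesAt : ∀ {N M} → AssignmentSeq N M → ℕ → ℕ
changesAt {N} 𝒜 t =
  length (filter (λ i → (toℕ i <? t) ×-dec ¬? (𝒜 t i ≟ 𝒜 (suc t) i)) (allFin N))

changesUpTo : ∀ {N M} → AssignmentSeq N M → ℕ → ℕ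
changesUpTo 𝒜 zero = 0
changesUpTo 𝒜 (suc n) = changesUpTo 𝒜 n + changesAt 𝒜 n

totalChanges : ∀ {N M} → AssignmentSeq N M → ℕ
totalChanges {N} 𝒜 = changesUpTo 𝒜 N

-- For L = 4q we build an interval graph: servers 0, …, L-1 lie on a line and each
-- client is adjacent either to a single server a (pinned) or to a and a + 1
-- (flexible).  With h = L/2, the clients arrive as a chain of L·h clients, arranged
-- so that every client on its lower server gives all loads h, followed by q rounds,
-- each inserting two pinned clients per server, first on the left half of the
-- servers and then on the right half.
--
-- The argument follows the potential Φ = sum of the server indices of all clients.
--  (1) Rigidity: if t = L·B clients can be assigned with all loads at most B, then
--      every optimal assignment has all loads exactly B, hence Φ = B·(0+…+(L-1)).
--  (2) Before every round and after its left half the instance is tight in this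
--      sense, witnessed by putting all clients on their lower resp. upper server.
--  (3) A client can only move by one server, so inserting a pinned client changes
--      Φ by its server index up to the number of reassignments.
-- Comparing (1)-(2) with (3), each half round forces h² changes, so the q rounds
-- force 2qh² = L³/8.  The file develops finite sums over ℕ, the translation of
-- loads and changes into such sums, rigidity, the potential estimate on interval
-- graphs, and finally the construction; the theorem comes last.
module Submission where

open import Defs
open import Data.Nat using (ℕ; zero; suc; _+_; _*_; _∸_; _^_; _⊓_; _⊔_; _≤_; _<_; _≤?_; _<?_; _≡ᵇ_; z≤n; s≤s; z<s; s<s; s<s⁻¹)
open import Data.Nat.Properties
open import Data.Nat.Divisibility using (_∣_; divides)
open import Data.Nat.Tactic.RingSolver using (solve-∀)
open import Algebra.Properties.CommutativeSemigroup +-commutativeSemigroup using (interchange; xy∙z≈xz∙y; xy∙z≈x∙zy)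
open import Data.Bool using (Bool; true; false; T; not; _∧_; _∨_)
open import Data.Bool.Properties using (T-∨)
import Data.Fin as F
open F using (Fin; toℕ; fromℕ<)
open import Data.Fin.Properties using (toℕ-fromℕ<; toℕ<n) renaming (_≟_ to _≟ᶠ_)
open import Data.List using (List; []; _∷_; _++_; length; replicate; filter; map; tabulate; allFin)
open import Data.List.Properties using (++-assoc; ++-identityʳ; length-++; length-replicate; foldr-preservesᵇ; foldr-preservesᵒ)
open import Data.List.Relation.Unary.All using (All; []; _∷_)
import Data.List.Relation.Unary.All.Properties as All
import Data.List.Relation.Unary.Any as Any
import Data.List.Relation.Unary.Any.Properties as Any
open import Data.List.Membership.Propositional.Properties using (∈-allFin)
open import Data.Product using (Σ; _×_; _,_; proj₁; proj₂)
open import Data.Sum using (_⊎_; inj₁; inj₂; [_,_])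
open import Data.Unit using (⊤)
open import Data.Empty using (⊥)
open import Function using (_∘_; Equivalence)
open import Relation.Binary.PropositionalEquality hiding ([_])
open import Relation.Nullary using (Dec; yes; no; does; ¬_)
open import Relation.Nullary.Decidable using (_×-dec_; ¬?)

ind : Bool → ℕ
ind true  = 1
ind false = 0

δ : ℕ → ℕ → ℕ
δ a b = ind (a ≡ᵇ b)

≡ᵇ-sym : ∀ a b → (a ≡ᵇ b) ≡ (b ≡ᵇ a)
≡ᵇ-sym zero    zero    = refl
≡ᵇ-sym zero    (suc b) = refl
≡ᵇ-sym (suc a) zero    = refl
≡ᵇ-sym (suc a) (suc b) = ≡ᵇ-sym a b

δ-sym : ∀ a b → δ a b ≡ δ b a
δ-sym a b = cong ind (≡ᵇ-sym a b)

sumTo : ℕ → (ℕ → ℕ) → ℕ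
sumTo zero    f = 0
sumTo (suc n) f = f 0 + sumTo n (f ∘ suc)

sumTo-cong : ∀ n {f g : ℕ → ℕ} → (∀ i → i < n → f i ≡ g i) → sumTo n f ≡ sumTo n g
sumTo-cong zero    e = refl
sumTo-cong (suc n) e = cong₂ _+_ (e 0 z<s) (sumTo-cong n (λ i p → e (suc i) (s<s p)))

sumTo-mono : ∀ n {f g : ℕ → ℕ} → (∀ i → i < n → f i ≤ g i) → sumTo n f ≤ sumTo n g
sumTo-mono zero    le = z≤n
sumTo-mono (suc n) le = +-mono-≤ (le 0 z<s) (sumTo-mono n (λ i p → le (suc i) (s<s p)))

sumTo-mono-< : ∀ n {f g : ℕ → ℕ} → (∀ i → i < n → f i ≤ g i) →
               ∀ s → s < n → f s < g s → sumTo n f < sumTo n g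
sumTo-mono-< (suc n) le zero    p lt = +-mono-<-≤ lt (sumTo-mono n (λ i q → le (suc i) (s<s q)))
sumTo-mono-< (suc n) le (suc s) p lt =
  +-mono-≤-< (le 0 z<s) (sumTo-mono-< n (λ i q → le (suc i) (s<s q)) s (s<s⁻¹ p) lt)

sumTo-+ : ∀ n (f g : ℕ → ℕ) → sumTo n (λ i → f i + g i) ≡ sumTo n f + sumTo n g
sumTo-+ zero    f g = refl
sumTo-+ (suc n) f g = trans (cong (f 0 + g 0 +_) (sumTo-+ n (f ∘ suc) (g ∘ suc)))
                            (interchange (f 0) (g 0) _ _)

sumTo-*ˡ : ∀ n c (f : ℕ → ℕ) → sumTo n (λ i → c * f i) ≡ c * sumTo n f
sumTo-*ˡ zero    c f = sym (*-zeroʳ c)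
sumTo-*ˡ (suc n) c f = trans (cong (c * f 0 +_) (sumTo-*ˡ n c (f ∘ suc))) (sym (*-distribˡ-+ c (f 0) _))

sumTo-const : ∀ n c → sumTo n (λ _ → c) ≡ n * c
sumTo-const zero    c = refl
sumTo-const (suc n) c = cong (c +_) (sumTo-const n c)

sumTo-vanish : ∀ n {f : ℕ → ℕ} → (∀ i → f i ≡ 0) → sumTo n f ≡ 0
sumTo-vanish n z = trans (sumTo-cong n (λ i _ → z i)) (trans (sumTo-const n 0) (*-zeroʳ n))

sumTo-snoc : ∀ n (f : ℕ → ℕ) → sumTo (suc n) f ≡ sumTo n f + f n
sumTo-snoc zero    f = +-comm (f 0) 0
sumTo-snoc (suc n) f = trans (cong (f 0 +_) (sumTo-snoc n (f ∘ suc))) (sym (+-assoc (f 0) _ _))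

sumTo-split : ∀ a b (f : ℕ → ℕ) → sumTo (a + b) f ≡ sumTo a f + sumTo b (λ i → f (a + i))
sumTo-split zero    b f = refl
sumTo-split (suc a) b f = trans (cong (f 0 +_) (sumTo-split a b (f ∘ suc))) (sym (+-assoc (f 0) _ _))

sift : ∀ n (g : ℕ → ℕ) x → x < n → sumTo n (λ j → g j * δ j x) ≡ g x
sift (suc n) g zero    p = trans (cong₂ _+_ (*-identityʳ (g 0)) (sumTo-vanish n (λ j → *-zeroʳ (g (suc j)))))
                                 (+-identityʳ (g 0))
sift (suc n) g (suc x) p = trans (cong (_+ sumTo n (λ j → g (suc j) * δ j x)) (*-zeroʳ (g 0)))
                                 (sift n (g ∘ suc) x (s<s⁻¹ p))

sift-beyond : ∀ n (g : ℕ → ℕ) x → n ≤ x → sumTo n (λ j → g j * δ j x) ≡ 0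
sift-beyond zero    g x       p         = refl
sift-beyond (suc n) g (suc x) (s≤s p) = trans (cong (_+ sumTo n (λ j → g (suc j) * δ j x)) (*-zeroʳ (g 0)))
                                              (sift-beyond n (g ∘ suc) x p)

sift-≤ : ∀ n (g : ℕ → ℕ) x → sumTo n (λ j → g j * δ j x) ≤ g x
sift-≤ n g x with x <? n
... | yes x<n = ≤-reflexive (sift n g x x<n)
... | no  x≮n = ≤-trans (≤-reflexive (sift-beyond n g x (≮⇒≥ x≮n))) z≤n

telescope-up : ∀ n (x a : ℕ → ℕ) → (∀ r → r < n → x (suc r) ≤ x r + a r) → x n ≤ x 0 + sumTo n a
telescope-up zero    x a step = m≤m+n (x 0) 0
telescope-up (suc n) x a step =
  begin
    x (suc n)
  ≤⟨ step n ≤-refl ⟩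
    x n + a n
  ≤⟨ +-monoˡ-≤ (a n) (telescope-up n x a (λ r r<n → step r (m<n⇒m<1+n r<n))) ⟩
    x 0 + sumTo n a + a n
  ≡⟨ trans (+-assoc (x 0) _ _) (cong (x 0 +_) (sym (sumTo-snoc n a))) ⟩
    x 0 + sumTo (suc n) a
  ∎
  where open ≤-Reasoning

telescope-down : ∀ n (x a b : ℕ → ℕ) → (∀ r → r < n → x r + a r ≤ x (suc r) + b r) →
                 x 0 + sumTo n a ≤ x n + sumTo n b
telescope-down zero    x a b step = ≤-refl
telescope-down (suc n) x a b step =
  begin
    x 0 + sumTo (suc n) a
  ≡⟨ trans (cong (x 0 +_) (sumTo-snoc n a)) (sym (+-assoc (x 0) _ _)) ⟩
    x 0 + sumTo n a + a n
  ≤⟨ +-monoˡ-≤ (a n) (telescope-down n x a b (λ r r<n → step r (m<n⇒m<1+n r<n))) ⟩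
    x n + sumTo n b + a n
  ≡⟨ xy∙z≈xz∙y (x n) (sumTo n b) (a n) ⟩
    x n + a n + sumTo n b
  ≤⟨ +-monoˡ-≤ (sumTo n b) (step n ≤-refl) ⟩
    x (suc n) + b n + sumTo n b
  ≡⟨ trans (+-assoc (x (suc n)) _ _) (cong (x (suc n) +_) (trans (+-comm (b n) _) (sym (sumTo-snoc n b)))) ⟩
    x (suc n) + sumTo (suc n) b
  ∎
  where open ≤-Reasoning

all-equal : ∀ n (f : ℕ → ℕ) B → (∀ i → i < n → f i ≤ B) → sumTo n f ≡ n * B →
            ∀ s → s < n → f s ≡ B
all-equal n f B le total s s<n = ≤-antisym (le s s<n) (≮⇒≥ short)
  where
  short : ¬ (f s < B)
  short fs<B = <-irrefl (trans total (sym (sumTo-const n B))) (sumTo-mono-< n le s s<n fs<B)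

finSum : ∀ {n} → (Fin n → ℕ) → ℕ
finSum {zero}  f = 0
finSum {suc n} f = f F.zero + finSum (f ∘ F.suc)

finSum-zero : ∀ {n} → finSum {n} (λ _ → 0) ≡ 0
finSum-zero {zero}  = refl
finSum-zero {suc n} = finSum-zero {n}

extend : ∀ {n} → (Fin n → ℕ) → ℕ → ℕ
extend {zero}  f i       = 0
extend {suc n} f zero    = f F.zero
extend {suc n} f (suc i) = extend (f ∘ F.suc) i

extend-fromℕ< : ∀ {n} (f : Fin n → ℕ) i (p : i < n) → extend f i ≡ f (fromℕ< p)
extend-fromℕ< {suc n} f zero    p = refl
extend-fromℕ< {suc n} f (suc i) p = extend-fromℕ< (f ∘ F.suc) i (s<s⁻¹ p)

length-filter-tabulate : ∀ {a p} {X : Set a} {P : X → Set p} (P? : ∀ x → Dec (P x)) {n} (g : Fin n → X) →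
  length (filter P? (tabulate g)) ≡ finSum (λ i → ind (does (P? (g i))))
length-filter-tabulate P? {zero}  g = refl
length-filter-tabulate P? {suc n} g with does (P? (g F.zero))
... | true  = cong suc (length-filter-tabulate P? (g ∘ F.suc))
... | false = length-filter-tabulate P? (g ∘ F.suc)

finSum-below : ∀ {n} (D : Fin n → Bool) t → t ≤ n →
  finSum (λ i → ind (does (toℕ i <? t) ∧ D i)) ≡ sumTo t (extend (ind ∘ D))
finSum-below {n}     D zero    _       = finSum-zero {n}
finSum-below {suc n} D (suc t) (s≤s p) = cong (ind (D F.zero) +_) (finSum-below (D ∘ F.suc) t p)

countBelow : ∀ {n p} {P : Fin n → Set p} (P? : ∀ i → Dec (P i)) t → t ≤ n →
  length (filter (λ i → (toℕ i <? t) ×-dec P? i) (allFin n)) ≡ sumTo t (extend (λ i → ind (does (P? i))))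
countBelow P? t t≤n = trans (length-filter-tabulate (λ i → (toℕ i <? t) ×-dec P? i) (λ i → i))
                            (finSum-below (λ i → does (P? i)) t t≤n)

does-≟ᶠ : ∀ {m} (x y : Fin m) → does (x ≟ᶠ y) ≡ (toℕ x ≡ᵇ toℕ y)
does-≟ᶠ F.zero    F.zero    = refl
does-≟ᶠ F.zero    (F.suc y) = refl
does-≟ᶠ (F.suc x) F.zero    = refl
does-≟ᶠ (F.suc x) (F.suc y) = does-≟ᶠ x y

-- pos A i: the server (as a number) of client i under A, extended by 0 beyond the last client.
pos : ∀ {N M} → Assignment N M → ℕ → ℕ
pos A = extend (toℕ ∘ A)

pos-bound : ∀ {N M} (A : Assignment N M) i → i < N → pos A i < M
pos-bound A i i<N = subst (_< _) (sym (extend-fromℕ< (toℕ ∘ A) i i<N)) (toℕ<n (A (fromℕ< i<N)))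

count : (ℕ → ℕ) → ℕ → ℕ → ℕ
count p t x = sumTo t (λ i → δ (p i) x)

load-count : ∀ {N M} (A : Assignment N M) t s → t ≤ N → load A t s ≡ count (pos A) t (toℕ s)
load-count A t s t≤N = trans (countBelow (λ i → A i ≟ᶠ s) t t≤N) (sumTo-cong t same)
  where
  same : ∀ i → i < t → extend (λ j → ind (does (A j ≟ᶠ s))) i ≡ δ (pos A i) (toℕ s)
  same i i<t = let i<N = ≤-trans i<t t≤N in
    trans (extend-fromℕ< _ i i<N)
          (trans (cong ind (does-≟ᶠ (A (fromℕ< i<N)) s))
                 (cong (λ z → δ z (toℕ s)) (sym (extend-fromℕ< (toℕ ∘ A) i i<N))))

differ : ℕ → ℕ → ℕ
differ a b = ind (not (a ≡ᵇ b))

changesAt-sum : ∀ {N M} (𝒜 : AssignmentSeq N M) t → t ≤ N →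
  changesAt 𝒜 t ≡ sumTo t (λ i → differ (pos (𝒜 t) i) (pos (𝒜 (suc t)) i))
changesAt-sum 𝒜 t t≤N = trans (countBelow (λ i → ¬? (𝒜 t i ≟ᶠ 𝒜 (suc t) i)) t t≤N) (sumTo-cong t same)
  where
  same : ∀ i → i < t → extend (λ j → ind (not (does (𝒜 t j ≟ᶠ 𝒜 (suc t) j)))) i
                      ≡ differ (pos (𝒜 t) i) (pos (𝒜 (suc t)) i)
  same i i<t = let i<N = ≤-trans i<t t≤N in
    trans (extend-fromℕ< _ i i<N)
          (trans (cong (ind ∘ not) (does-≟ᶠ (𝒜 t (fromℕ< i<N)) (𝒜 (suc t) (fromℕ< i<N))))
                 (sym (cong₂ differ (extend-fromℕ< (toℕ ∘ 𝒜 t) i i<N) (extend-fromℕ< (toℕ ∘ 𝒜 (suc t)) i i<N))))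

changes-window : ∀ {N M} (𝒜 : AssignmentSeq N M) a n →
  changesUpTo 𝒜 (a + n) ≡ changesUpTo 𝒜 a + sumTo n (λ r → changesAt 𝒜 (a + r))
changes-window 𝒜 a n =
  trans (as-sum (a + n))
        (trans (sumTo-split a n (changesAt 𝒜)) (cong (_+ sumTo n (λ r → changesAt 𝒜 (a + r))) (sym (as-sum a))))
  where
  as-sum : ∀ n → changesUpTo 𝒜 n ≡ sumTo n (changesAt 𝒜)
  as-sum zero    = refl
  as-sum (suc n) = trans (cong (_+ changesAt 𝒜 n) (as-sum n)) (sym (sumTo-snoc n (changesAt 𝒜)))

load≤maxLoad : ∀ {N M} (A : Assignment N M) t s → load A t s ≤ maxLoad A t
load≤maxLoad {M = M} A t s = foldr-preservesᵒ pres 0 (map (load A t) (allFin M)) (inj₂ here)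
  where
  pres : ∀ x y → load A t s ≤ x ⊎ load A t s ≤ y → load A t s ≤ x ⊔ y
  pres x y = [ (λ p → ≤-trans p (m≤m⊔n x y)) , (λ p → ≤-trans p (m≤n⊔m x y)) ]
  here : Any.Any (load A t s ≤_) (map (load A t) (allFin M))
  here = Any.map⁺ (Any.map (λ s≡x → ≤-reflexive (cong (load A t) s≡x)) (∈-allFin s))

maxLoad≤ : ∀ {N M} (A : Assignment N M) t B → (∀ s → load A t s ≤ B) → maxLoad A t ≤ B
maxLoad≤ A t B le = foldr-preservesᵇ {P = _≤ B} ⊔-lub z≤n (All.map⁺ (All.tabulate⁺ le))

double-count : ∀ L t (p g : ℕ → ℕ) → (∀ i → i < t → p i < L) →
  sumTo L (λ s → g s * count p t s) ≡ sumTo t (g ∘ p)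
double-count L zero    p g _ = sumTo-vanish L (λ s → *-zeroʳ (g s))
double-count L (suc t) p g b =
  begin
    sumTo L (λ s → g s * count p (suc t) s)
  ≡⟨ sumTo-cong L (λ s _ → trans (*-distribˡ-+ (g s) _ _)
                                 (cong (λ z → g s * z + g s * count (p ∘ suc) t s) (δ-sym (p 0) s))) ⟩
    sumTo L (λ s → g s * δ s (p 0) + g s * count (p ∘ suc) t s)
  ≡⟨ sumTo-+ L _ _ ⟩
    sumTo L (λ s → g s * δ s (p 0)) + sumTo L (λ s → g s * count (p ∘ suc) t s)
  ≡⟨ cong₂ _+_ (sift L g (p 0) (b 0 z<s)) (double-count L t (p ∘ suc) g (λ i q → b (suc i) (s<s q))) ⟩
    g (p 0) + sumTo t (g ∘ p ∘ suc)
  ∎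
  where open ≡-Reasoning

-- Every present client sits on exactly one server, so the loads add up to t.
loads-sum : ∀ {N L} (A : Assignment N L) t → t ≤ N → sumTo L (count (pos A) t) ≡ t
loads-sum {L = L} A t t≤N =
  begin
    sumTo L (count (pos A) t)
  ≡⟨ sumTo-cong L (λ s _ → sym (*-identityˡ _)) ⟩
    sumTo L (λ s → 1 * count (pos A) t s)
  ≡⟨ double-count L t (pos A) (λ _ → 1) (λ i i<t → pos-bound A i (≤-trans i<t t≤N)) ⟩
    sumTo t (λ _ → 1)
  ≡⟨ trans (sumTo-const t 1) (*-identityʳ t) ⟩
    t
  ∎
  where open ≡-Reasoning

count≤maxLoad : ∀ {N L} (A : Assignment N L) t s → t ≤ N → s < L → count (pos A) t s ≤ maxLoad A t
count≤maxLoad A t s t≤N s<L =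
  subst (_≤ maxLoad A t)
        (trans (load-count A t (fromℕ< s<L) t≤N) (cong (count (pos A) t) (toℕ-fromℕ< s<L)))
        (load≤maxLoad A t (fromℕ< s<L))

clients≤L*maxLoad : ∀ {N L} (A : Assignment N L) t → t ≤ N → t ≤ L * maxLoad A t
clients≤L*maxLoad {L = L} A t t≤N =
  begin
    t
  ≡⟨ sym (loads-sum A t t≤N) ⟩
    sumTo L (count (pos A) t)
  ≤⟨ sumTo-mono L (λ s s<L → count≤maxLoad A t s t≤N s<L) ⟩
    sumTo L (λ _ → maxLoad A t)
  ≡⟨ sumTo-const L _ ⟩
    L * maxLoad A t
  ∎
  where open ≤-Reasoning

optimal-balanced : ∀ {N L} (G : BipGraph N L) (A W : Assignment N L) t B → t ≤ N → t ≡ L * B →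
  ValidAt G t W → (∀ s → load W t s ≤ B) → OptimalAt G t A →
  ∀ s → s < L → count (pos A) t s ≡ B
optimal-balanced {L = L} G A W t B t≤N t≡LB W-valid W≤B (_ , A-optimal) =
  all-equal L (count (pos A) t) B (λ s s<L → ≤-trans (count≤maxLoad A t s t≤N s<L) A≤B)
            (trans (loads-sum A t t≤N) t≡LB)
  where
  A≤B : maxLoad A t ≤ B
  A≤B = ≤-trans (A-optimal W W-valid) (maxLoad≤ W t B W≤B)

potential : ∀ {N L} → Assignment N L → ℕ → ℕ
potential A t = sumTo t (pos A)

balanced-potential : ∀ {N L} (G : BipGraph N L) (A W : Assignment N L) t B → t ≤ N → t ≡ L * B →
  ValidAt G t W → (∀ s → load W t s ≤ B) → OptimalAt G t A →
  potential A t ≡ B * sumTo L (λ s → s)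
balanced-potential {L = L} G A W t B t≤N t≡LB W-valid W≤B A-optimal =
  begin
    sumTo t (pos A)
  ≡⟨ sym (double-count L t (pos A) (λ s → s) (λ i i<t → pos-bound A i (≤-trans i<t t≤N))) ⟩
    sumTo L (λ s → s * count (pos A) t s)
  ≡⟨ sumTo-cong L (λ s s<L → trans (cong (s *_) (optimal-balanced G A W t B t≤N t≡LB W-valid W≤B A-optimal s s<L))
                                   (*-comm s B)) ⟩
    sumTo L (λ s → B * s)
  ≡⟨ sumTo-*ˡ L B (λ s → s) ⟩
    B * sumTo L (λ s → s)
  ∎
  where open ≡-Reasoning

-- A client of an interval graph is adjacent either to one server a (pinned)
-- or to the two consecutive servers a and a + 1 (flexible).
data Client : Set where
  pinned flexible : ℕ → Client

lower upper : Client → ℕ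
lower (pinned a)   = a
lower (flexible a) = a
upper (pinned a)   = a
upper (flexible a) = suc a

Pinned : Client → Set
Pinned (pinned _)   = ⊤
Pinned (flexible _) = ⊥

adjacentᵇ : Client → ℕ → Bool
adjacentᵇ c x = (x ≡ᵇ lower c) ∨ (x ≡ᵇ upper c)

intervalGraph : ∀ {N L} → (ℕ → Client) → BipGraph N L
intervalGraph client i s = adjacentᵇ (client (toℕ i)) (toℕ s)

Window : ℕ → ℕ → Set
Window a x = a ≤ x × x ≤ suc a

adjacent-lower : ∀ c → T (adjacentᵇ c (lower c))
adjacent-lower c =
  Equivalence.from (T-∨ {lower c ≡ᵇ lower c} {lower c ≡ᵇ upper c}) (inj₁ (≡⇒≡ᵇ (lower c) (lower c) refl))

adjacent-upper : ∀ c → T (adjacentᵇ c (upper c))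
adjacent-upper c =
  Equivalence.from (T-∨ {upper c ≡ᵇ lower c} {upper c ≡ᵇ upper c}) (inj₂ (≡⇒≡ᵇ (upper c) (upper c) refl))

adjacent-cases : ∀ c x → T (adjacentᵇ c x) → x ≡ lower c ⊎ x ≡ upper c
adjacent-cases c x adj with Equivalence.to (T-∨ {x ≡ᵇ lower c} {x ≡ᵇ upper c}) adj
... | inj₁ e = inj₁ (≡ᵇ⇒≡ x (lower c) e)
... | inj₂ e = inj₂ (≡ᵇ⇒≡ x (upper c) e)

upper-window : ∀ c → Window (lower c) (upper c)
upper-window (pinned a)   = ≤-refl , n≤1+n a
upper-window (flexible a) = n≤1+n a , ≤-refl

adjacent-window : ∀ c x → T (adjacentᵇ c x) → Window (lower c) x
adjacent-window c x adj with adjacent-cases c x adj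
... | inj₁ refl = ≤-refl , n≤1+n x
... | inj₂ refl = upper-window c

adjacent-pinned : ∀ c x → Pinned c → T (adjacentᵇ c x) → x ≡ lower c
adjacent-pinned (pinned a) x _ adj with adjacent-cases (pinned a) x adj
... | inj₁ x≡a = x≡a
... | inj₂ x≡a = x≡a

window-step : ∀ {a x y} → Window a x → Window a y → y ≤ x + differ x y
window-step {a} {x} {y} (a≤x , _) (_ , y≤a+1) with x ≡ᵇ y in eq
... | true  = ≤-trans (≤-reflexive (sym (≡ᵇ⇒≡ x y (subst T (sym eq) _)))) (m≤m+n x 0)
... | false = ≤-trans y≤a+1 (≤-trans (s≤s a≤x) (≤-reflexive (+-comm 1 x)))

differ-sym : ∀ x y → differ x y ≡ differ y x
differ-sym x y = cong (ind ∘ not) (≡ᵇ-sym x y)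

windows-sum : ∀ t (a p p' : ℕ → ℕ) → (∀ i → i < t → Window (a i) (p i) × Window (a i) (p' i)) →
  sumTo t p' ≤ sumTo t p + sumTo t (λ i → differ (p i) (p' i))
windows-sum t a p p' windows =
  ≤-trans (sumTo-mono t (λ i i<t → window-step (proj₁ (windows i i<t)) (proj₂ (windows i i<t))))
          (≤-reflexive (sumTo-+ t p (λ i → differ (p i) (p' i))))

module IntervalGraph {N L : ℕ} (client : ℕ → Client) where

  G : BipGraph N L
  G = intervalGraph client

  valid-adjacent : ∀ (A : Assignment N L) t → ValidAt G t A → t ≤ N →
                   ∀ i → i < t → T (adjacentᵇ (client i) (pos A i))
  valid-adjacent A t valid t≤N i i<t =
    subst₂ (λ k x → T (adjacentᵇ (client k) x)) (toℕ-fromℕ< i<N) (sym (extend-fromℕ< (toℕ ∘ A) i i<N))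
           (valid (fromℕ< i<N) (subst (_< t) (sym (toℕ-fromℕ< i<N)) i<t))
    where
    i<N : i < N
    i<N = ≤-trans i<t t≤N

  -- Inserting a pinned client at time t raises the potential by the index of its
  -- server, up to the number of changes (each change moves a client by one server).
  pinned-step : ∀ (𝒜 : AssignmentSeq N L) t → suc t ≤ N →
    ValidAt G t (𝒜 t) → ValidAt G (suc t) (𝒜 (suc t)) → Pinned (client t) →
    potential (𝒜 (suc t)) (suc t) ≤ potential (𝒜 t) t + (lower (client t) + changesAt 𝒜 t)
    × potential (𝒜 t) t + lower (client t) ≤ potential (𝒜 (suc t)) (suc t) + changesAt 𝒜 t
  pinned-step 𝒜 t t<N valid valid' pin = up , down
    where
    open ≤-Reasoning
    p p' : ℕ → ℕ
    p  = pos (𝒜 t)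
    p' = pos (𝒜 (suc t))
    a ch : ℕ
    a  = lower (client t)
    ch = changesAt 𝒜 t
    windows : ∀ i → i < t → Window (lower (client i)) (p i) × Window (lower (client i)) (p' i)
    windows i i<t =
      adjacent-window (client i) (p i) (valid-adjacent (𝒜 t) t valid (<⇒≤ t<N) i i<t) ,
      adjacent-window (client i) (p' i) (valid-adjacent (𝒜 (suc t)) (suc t) valid' t<N i (m<n⇒m<1+n i<t))
    changes : ch ≡ sumTo t (λ i → differ (p i) (p' i))
    changes = changesAt-sum 𝒜 t (<⇒≤ t<N)
    changes' : ch ≡ sumTo t (λ i → differ (p' i) (p i))
    changes' = trans changes (sumTo-cong t (λ i _ → differ-sym (p i) (p' i)))
    newcomer : p' t ≡ a
    newcomer = adjacent-pinned (client t) (p' t) pin (valid-adjacent (𝒜 (suc t)) (suc t) valid' t<N t ≤-refl)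
    after : potential (𝒜 (suc t)) (suc t) ≡ sumTo t p' + a
    after = trans (sumTo-snoc t p') (cong (sumTo t p' +_) newcomer)
    up : potential (𝒜 (suc t)) (suc t) ≤ potential (𝒜 t) t + (a + ch)
    up = begin
        potential (𝒜 (suc t)) (suc t)
      ≡⟨ after ⟩
        sumTo t p' + a
      ≤⟨ +-monoˡ-≤ a (subst (λ c → sumTo t p' ≤ sumTo t p + c) (sym changes) (windows-sum t _ p p' windows)) ⟩
        sumTo t p + ch + a
      ≡⟨ xy∙z≈x∙zy (sumTo t p) ch a ⟩
        sumTo t p + (a + ch)
      ∎
    down : potential (𝒜 t) t + a ≤ potential (𝒜 (suc t)) (suc t) + ch
    down = begin
        sumTo t p + a
      ≤⟨ +-monoˡ-≤ a (subst (λ c → sumTo t p ≤ sumTo t p' + c) (sym changes')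
                            (windows-sum t _ p' p (λ i i<t → proj₂ (windows i i<t) , proj₁ (windows i i<t)))) ⟩
        sumTo t p' + ch + a
      ≡⟨ xy∙z≈xz∙y (sumTo t p') ch a ⟩
        sumTo t p' + a + ch
      ≡⟨ cong (_+ ch) (sym after) ⟩
        potential (𝒜 (suc t)) (suc t) + ch
      ∎

  pinned-run : ∀ (𝒜 : AssignmentSeq N L) → (∀ t → t ≤ N → ValidAt G t (𝒜 t)) →
    ∀ t₀ n → t₀ + n ≤ N → (∀ r → r < n → Pinned (client (t₀ + r))) →
    let servers = sumTo n (λ r → lower (client (t₀ + r)))
        moves   = sumTo n (λ r → changesAt 𝒜 (t₀ + r))
    in potential (𝒜 (t₀ + n)) (t₀ + n) ≤ potential (𝒜 t₀) t₀ + (servers + moves)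
       × potential (𝒜 t₀) t₀ + servers ≤ potential (𝒜 (t₀ + n)) (t₀ + n) + moves
  pinned-run 𝒜 valid t₀ n run≤N pin =
    subst (λ z → x n ≤ z + (servers + moves)) start
          (≤-trans (telescope-up n x (λ r → a r + c r) (λ r r<n → proj₁ (step r r<n)))
                   (≤-reflexive (cong (x 0 +_) (sumTo-+ n a c)))) ,
    subst (λ z → z + servers ≤ x n + moves) start (telescope-down n x a c (λ r r<n → proj₂ (step r r<n)))
    where
    x a c : ℕ → ℕ
    x r = potential (𝒜 (t₀ + r)) (t₀ + r)
    a r = lower (client (t₀ + r))
    c r = changesAt 𝒜 (t₀ + r)
    servers moves : ℕ
    servers = sumTo n a
    moves   = sumTo n c
    start : x 0 ≡ potential (𝒜 t₀) t₀
    start = cong (λ u → potential (𝒜 u) u) (+-identityʳ t₀)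
    step : ∀ r → r < n → x (suc r) ≤ x r + (a r + c r) × x r + a r ≤ x (suc r) + c r
    step r r<n = subst (λ u → potential (𝒜 u) u ≤ x r + (a r + c r) × x r + a r ≤ potential (𝒜 u) u + c r)
                       (sym (+-suc t₀ r))
                       (pinned-step 𝒜 (t₀ + r) t<N (valid (t₀ + r) (<⇒≤ t<N)) (valid (suc (t₀ + r)) t<N) (pin r r<n))
      where
      t<N : suc (t₀ + r) ≤ N
      t<N = ≤-trans (≤-reflexive (sym (+-suc t₀ r))) (≤-trans (+-monoʳ-≤ t₀ r<n) run≤N)

nth : List Client → ℕ → Client
nth []       i       = pinned 0
nth (c ∷ cs) zero    = c
nth (c ∷ cs) (suc i) = nth cs i

nth-++ : ∀ xs ys r → nth (xs ++ ys) (length xs + r) ≡ nth ys r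
nth-++ []       ys r = refl
nth-++ (x ∷ xs) ys r = nth-++ xs ys r

nth-++-< : ∀ xs ys r → r < length xs → nth (xs ++ ys) r ≡ nth xs r
nth-++-< (x ∷ xs) ys zero    _   = refl
nth-++-< (x ∷ xs) ys (suc r) r<n = nth-++-< xs ys r (s<s⁻¹ r<n)

nth-All : ∀ {P : Client → Set} xs → All P xs → ∀ i → i < length xs → P (nth xs i)
nth-All (x ∷ xs) (px ∷ _)   zero    _   = px
nth-All (x ∷ xs) (_  ∷ pxs) (suc i) i<n = nth-All xs pxs i (s<s⁻¹ i<n)

weight : (Client → ℕ) → List Client → ℕ
weight f []       = 0
weight f (c ∷ cs) = f c + weight f cs

weight-++ : ∀ f xs ys → weight f (xs ++ ys) ≡ weight f xs + weight f ys
weight-++ f []       ys = refl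
weight-++ f (x ∷ xs) ys = trans (cong (f x +_) (weight-++ f xs ys)) (sym (+-assoc (f x) _ _))

weight-replicate : ∀ f m c → weight f (replicate m c) ≡ m * f c
weight-replicate f zero    c = refl
weight-replicate f (suc m) c = cong (f c +_) (weight-replicate f m c)

weight-prefix : ∀ f xs ys → sumTo (length xs) (f ∘ nth (xs ++ ys)) ≡ weight f xs
weight-prefix f []       ys = refl
weight-prefix f (x ∷ xs) ys = cong (f x +_) (weight-prefix f xs ys)

blocks : (ℕ → List Client) → ℕ → List Client
blocks g zero    = []
blocks g (suc n) = g 0 ++ blocks (g ∘ suc) n

blocks-+ : ∀ g a b → blocks g (a + b) ≡ blocks g a ++ blocks (λ j → g (a + j)) b
blocks-+ g zero    b = refl
blocks-+ g (suc a) b = trans (cong (g 0 ++_) (blocks-+ (g ∘ suc) a b)) (sym (++-assoc (g 0) _ _))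

weight-blocks : ∀ f g n → weight f (blocks g n) ≡ sumTo n (weight f ∘ g)
weight-blocks f g zero    = refl
weight-blocks f g (suc n) = trans (weight-++ f (g 0) _) (cong (weight f (g 0) +_) (weight-blocks f (g ∘ suc) n))

length-blocks : ∀ g n → length (blocks g n) ≡ sumTo n (length ∘ g)
length-blocks g zero    = refl
length-blocks g (suc n) = trans (length-++ (g 0)) (cong (length (g 0) +_) (length-blocks (g ∘ suc) n))

All-blocks : ∀ {P : Client → Set} g n → (∀ j → j < n → All P (g j)) → All P (blocks g n)
All-blocks g zero    all = []
All-blocks g (suc n) all = All.++⁺ (all 0 z<s) (All-blocks (g ∘ suc) n (λ j j<n → all (suc j) (s<s j<n)))

All-replicate : ∀ {P : Client → Set} m c → (0 < m → P c) → All P (replicate m c)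
All-replicate zero    c pc = []
All-replicate (suc m) c pc = All.replicate⁺ (suc m) (pc z<s)

∸-suc : ∀ m n → n < m → m ∸ n ≡ suc (m ∸ suc n)
∸-suc (suc m) zero    _   = refl
∸-suc (suc m) (suc n) n<m = ∸-suc m n (s<s⁻¹ n<m)

square-≤ : ∀ L m → L * L ≤ L * m → L ≤ m
square-≤ zero    m _  = z≤n
square-≤ (suc L) m le = *-cancelˡ-≤ (suc L) le

-- The bookkeeping of one round of the lower bound.  Writing the server sum as
-- S = Sˡ + Sʳ with Sʳ = E + Sˡ, each half of a round forces E changes.
excess-moves : ∀ Sˡ Sʳ E C → Sʳ ≡ E + Sˡ → Sʳ ≤ Sˡ + C → E ≤ C
excess-moves Sˡ Sʳ E C Sʳ≡ le = +-cancelʳ-≤ Sˡ E C (subst₂ _≤_ Sʳ≡ (+-comm Sˡ C) le)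

-- Left half: the potential climbs from B·S to (B+1)·S, the newcomers bring 2Sˡ.
first-half-moves : ∀ B Sˡ Sʳ E C → Sʳ ≡ E + Sˡ →
  suc B * (Sˡ + Sʳ) ≤ B * (Sˡ + Sʳ) + ((Sˡ + Sˡ) + C) → E ≤ C
first-half-moves B Sˡ Sʳ E C Sʳ≡ le =
  excess-moves Sˡ Sʳ E C Sʳ≡ (+-cancelˡ-≤ Sˡ Sʳ (Sˡ + C) (+-cancelˡ-≤ (B * (Sˡ + Sʳ)) (Sˡ + Sʳ) (Sˡ + (Sˡ + C))
    (subst₂ _≤_ (+-comm (Sˡ + Sʳ) _) (cong (B * (Sˡ + Sʳ) +_) (+-assoc Sˡ Sˡ C)) le)))

-- Right half: the potential climbs from (B+1)·S to (B+2)·S, the newcomers bring 2Sʳ.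
second-half-moves : ∀ B Sˡ Sʳ E C → Sʳ ≡ E + Sˡ →
  suc B * (Sˡ + Sʳ) + (Sʳ + Sʳ) ≤ suc (suc B) * (Sˡ + Sʳ) + C → E ≤ C
second-half-moves B Sˡ Sʳ E C Sʳ≡ le =
  excess-moves Sˡ Sʳ E C Sʳ≡ (+-cancelˡ-≤ Sʳ Sʳ (Sˡ + C) (+-cancelˡ-≤ (suc B * (Sˡ + Sʳ)) (Sʳ + Sʳ) (Sʳ + (Sˡ + C))
    (≤-trans le (≤-reflexive (rearrange (suc B * (Sˡ + Sʳ)) Sˡ Sʳ C)))))
  where
  rearrange : ∀ X a b c → a + b + X + c ≡ X + (b + (a + c))
  rearrange = solve-∀

module Construction (q : ℕ) where

  h L N : ℕ
  h = q + q
  L = h + h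
  N = L * L

  L∸h : L ∸ h ≡ h
  L∸h = m+n∸n≡m h h

  -- flow s: the number of flexible clients between servers s and s + 1.  It grows
  -- by one per server up to the middle of the line of servers, then falls to 0.
  flow : ℕ → ℕ
  flow s = suc s ⊓ (L ∸ suc s)

  flow≤h : ∀ s → flow s ≤ h
  flow≤h s with suc s ≤? h
  ... | yes s<h = ≤-trans (m⊓n≤m (suc s) _) s<h
  ... | no  s≮h = ≤-trans (m⊓n≤n (suc s) _) (≤-trans (∸-monoʳ-≤ L (<⇒≤ (≰⇒> s≮h))) (≤-reflexive L∸h))

  flow-rising : ∀ s → s < h → flow s ≡ suc s
  flow-rising s s<h = m≤n⇒m⊓n≡m (≤-trans s<h (≤-trans (≤-reflexive (sym L∸h)) (∸-monoʳ-≤ L s<h)))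

  flow-falling : ∀ s → h ≤ s → flow s ≡ L ∸ suc s
  flow-falling s h≤s = m≥n⇒m⊓n≡n (≤-trans (∸-monoʳ-≤ L (m≤n⇒m≤1+n h≤s))
                                          (≤-trans (≤-reflexive L∸h) (m≤n⇒m≤1+n h≤s)))

  inflow : ℕ → ℕ
  inflow zero    = 0
  inflow (suc y) = flow y

  inflow≤ : ∀ x → inflow x ≤ x
  inflow≤ zero    = z≤n
  inflow≤ (suc y) = m⊓n≤m (suc y) _

  inflow≤rest : ∀ x → inflow x ≤ L ∸ x
  inflow≤rest zero    = z≤n
  inflow≤rest (suc y) = m⊓n≤n (suc y) _

  -- With every flexible client on its upper server, servers of the left half
  -- lose one client and servers of the right half gain one.
  tent-left : ∀ x → x < h → suc ((h ∸ flow x) + inflow x) ≤ h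
  tent-left x x<h =
    begin
      suc ((h ∸ flow x) + inflow x)
    ≤⟨ s≤s (+-mono-≤ (≤-reflexive (cong (h ∸_) (flow-rising x x<h))) (inflow≤ x)) ⟩
      suc ((h ∸ suc x) + x)
    ≡⟨ trans (sym (+-suc (h ∸ suc x) x)) (m∸n+n≡m x<h) ⟩
      h
    ∎
    where open ≤-Reasoning

  tent-right : ∀ x → h ≤ x → x < L → (h ∸ flow x) + inflow x ≤ suc h
  tent-right x h≤x x<L =
    begin
      (h ∸ flow x) + inflow x
    ≤⟨ +-monoʳ-≤ (h ∸ flow x) (≤-trans (inflow≤rest x) (≤-reflexive (∸-suc L x x<L))) ⟩
      (h ∸ flow x) + suc (L ∸ suc x)
    ≡⟨ cong (λ u → (h ∸ u) + suc (L ∸ suc x)) (flow-falling x h≤x) ⟩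
      (h ∸ (L ∸ suc x)) + suc (L ∸ suc x)
    ≡⟨ trans (+-suc (h ∸ (L ∸ suc x)) _) (cong suc (m∸n+n≡m (subst (_≤ h) (flow-falling x h≤x) (flow≤h x)))) ⟩
      suc h
    ∎
    where open ≤-Reasoning

  chainBlock : ℕ → List Client
  chainBlock s = replicate (flow s) (flexible s) ++ replicate (h ∸ flow s) (pinned s)

  chain : List Client
  chain = blocks chainBlock L

  twoAt : ℕ → List Client
  twoAt s = pinned s ∷ pinned s ∷ []

  round leftHalf rightHalf : List Client
  round     = blocks twoAt L
  leftHalf  = blocks twoAt h
  rightHalf = blocks (twoAt ∘ (h +_)) h

  round-halves : round ≡ leftHalf ++ rightHalf
  round-halves = blocks-+ twoAt h h

  rounds : ℕ → List Client
  rounds zero    = []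
  rounds (suc k) = rounds k ++ round

  rounds-+ : ∀ k m → rounds (k + m) ≡ rounds k ++ rounds m
  rounds-+ k zero    = trans (cong rounds (+-identityʳ k)) (sym (++-identityʳ (rounds k)))
  rounds-+ k (suc m) = trans (cong rounds (+-suc k m))
                             (trans (cong (_++ round) (rounds-+ k m)) (++-assoc (rounds k) (rounds m) round))

  clients : List Client
  clients = chain ++ rounds q

  client : ℕ → Client
  client = nth clients

  open IntervalGraph {N} {L} client public

  -- Sizes: a chain block has h clients and a round 2L = 4h, so after the chain
  -- and k rounds there are L * level k clients, where level k = h + 2k.
  level : ℕ → ℕ
  level k = h + (k + k)

  time mid : ℕ → ℕ
  time k = length (chain ++ rounds k)
  mid  k = length ((chain ++ rounds k) ++ leftHalf)

  length-chain : length chain ≡ L * h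
  length-chain = trans (length-blocks chainBlock L) (trans (sumTo-cong L (λ s _ → block-size s)) (sumTo-const L h))
    where
    block-size : ∀ s → length (chainBlock s) ≡ h
    block-size s = trans (length-++ (replicate (flow s) (flexible s)))
                         (trans (cong₂ _+_ (length-replicate (flow s)) (length-replicate (h ∸ flow s)))
                                (m+[n∸m]≡n (flow≤h s)))

  length-leftHalf : length leftHalf ≡ h * 2
  length-leftHalf = trans (length-blocks twoAt h) (sumTo-const h 2)

  length-rounds : ∀ k → length (rounds k) ≡ k * (L * 2)
  length-rounds zero    = refl
  length-rounds (suc k) =
    trans (length-++ (rounds k))
          (trans (cong₂ _+_ (length-rounds k) (trans (length-blocks twoAt L) (sumTo-const L 2)))
                 (+-comm (k * (L * 2)) (L * 2)))

  time-level : ∀ k → time k ≡ L * level k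
  time-level k = trans (length-++ chain) (trans (cong₂ _+_ length-chain (length-rounds k)) (arith h k))
    where
    arith : ∀ h k → (h + h) * h + k * ((h + h) * 2) ≡ (h + h) * (h + (k + k))
    arith = solve-∀

  mid-level : ∀ k → mid k ≡ L * suc (level k)
  mid-level k = trans (length-++ (chain ++ rounds k))
                      (trans (cong₂ _+_ (time-level k) length-leftHalf) (arith h k))
    where
    arith : ∀ h k → (h + h) * (h + (k + k)) + h * 2 ≡ (h + h) * suc (h + (k + k))
    arith = solve-∀

  after-rounds : ∀ k → k ≤ q → clients ≡ (chain ++ rounds k) ++ rounds (q ∸ k)
  after-rounds k k≤q =
    begin
      chain ++ rounds q
    ≡⟨ cong (λ m → chain ++ rounds m) (sym (m+[n∸m]≡n k≤q)) ⟩
      chain ++ rounds (k + (q ∸ k))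
    ≡⟨ cong (chain ++_) (rounds-+ k (q ∸ k)) ⟩
      chain ++ (rounds k ++ rounds (q ∸ k))
    ≡⟨ sym (++-assoc chain (rounds k) _) ⟩
      (chain ++ rounds k) ++ rounds (q ∸ k)
    ∎
    where open ≡-Reasoning

  round-prefix : ∀ k → chain ++ rounds (suc k) ≡ ((chain ++ rounds k) ++ leftHalf) ++ rightHalf
  round-prefix k =
    begin
      chain ++ (rounds k ++ round)
    ≡⟨ sym (++-assoc chain (rounds k) round) ⟩
      (chain ++ rounds k) ++ round
    ≡⟨ cong ((chain ++ rounds k) ++_) round-halves ⟩
      (chain ++ rounds k) ++ (leftHalf ++ rightHalf)
    ≡⟨ sym (++-assoc (chain ++ rounds k) leftHalf rightHalf) ⟩
      ((chain ++ rounds k) ++ leftHalf) ++ rightHalf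
    ∎
    where open ≡-Reasoning

  length-clients : length clients ≡ N
  length-clients = time-level q

  prefix-bound : ∀ pre rest → clients ≡ pre ++ rest → length pre ≤ N
  prefix-bound pre rest split =
    subst (length pre ≤_) (trans (sym (length-++ pre)) (trans (cong length (sym split)) length-clients))
          (m≤m+n (length pre) (length rest))

  -- All servers named by the clients exist: flexible clients at s occur only
  -- when flow s > 0, which forces s + 1 < L.
  flexible-exists : ∀ s → 0 < flow s → suc s < L
  flexible-exists s pos = m∸n≢0⇒n<m (>⇒≢ (≤-trans pos (m⊓n≤n (suc s) _)))

  servers-exist : All (λ c → upper c < L) clients
  servers-exist = All.++⁺ (All-blocks chainBlock L (λ s s<L →
                            All.++⁺ (All-replicate (flow s) (flexible s) (flexible-exists s))
                                    (All.replicate⁺ (h ∸ flow s) s<L)))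
                          (in-rounds q)
    where
    in-rounds : ∀ k → All (λ c → upper c < L) (rounds k)
    in-rounds zero    = []
    in-rounds (suc k) = All.++⁺ (in-rounds k) (All-blocks twoAt L (λ s s<L → s<L ∷ s<L ∷ []))

  upper-bound : ∀ i → i < N → upper (client i) < L
  upper-bound i i<N = nth-All clients servers-exist i (subst (i <_) (sym length-clients) i<N)
  lower-bound : ∀ i → i < N → lower (client i) < L
  lower-bound i i<N = ≤-<-trans (proj₁ (upper-window (client i))) (upper-bound i i<N)

  mode : (π : Client → ℕ) → (∀ i → i < N → π (client i) < L) → Assignment N L
  mode π bound i = fromℕ< (bound (toℕ i) (toℕ<n i))

  pos-mode : ∀ π bound i → i < N → pos (mode π bound) i ≡ π (client i)
  pos-mode π bound i i<N = trans (extend-fromℕ< (toℕ ∘ mode π bound) i i<N)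
                                 (trans (toℕ-fromℕ< _) (cong (π ∘ client) (toℕ-fromℕ< i<N)))

  mode-valid : ∀ π bound → (∀ c → T (adjacentᵇ c (π c))) → ∀ t → ValidAt G t (mode π bound)
  mode-valid π bound adjacent t i _ =
    subst (T ∘ adjacentᵇ (client (toℕ i))) (sym (toℕ-fromℕ< (bound (toℕ i) (toℕ<n i)))) (adjacent (client (toℕ i)))

  mode-load : ∀ π bound pre rest → clients ≡ pre ++ rest → ∀ s →
              load (mode π bound) (length pre) s ≡ weight (λ c → δ (π c) (toℕ s)) pre
  mode-load π bound pre rest split s =
    trans (load-count (mode π bound) (length pre) s t≤N)
          (trans (sumTo-cong (length pre) (λ i i<t → cong (λ x → δ x (toℕ s)) (at i (≤-trans i<t t≤N))))
                 (weight-prefix (λ c → δ (π c) (toℕ s)) pre rest))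
    where
    t≤N : length pre ≤ N
    t≤N = prefix-bound pre rest split
    at : ∀ i → i < N → pos (mode π bound) i ≡ π (nth (pre ++ rest) i)
    at i i<N = trans (pos-mode π bound i i<N) (cong (λ cs → π (nth cs i)) split)

  leftMode rightMode : Assignment N L
  leftMode  = mode lower lower-bound
  rightMode = mode upper upper-bound

  chainBlock-weight : ∀ f s → weight f (chainBlock s) ≡ flow s * f (flexible s) + (h ∸ flow s) * f (pinned s)
  chainBlock-weight f s = trans (weight-++ f (replicate (flow s) (flexible s)) _)
    (cong₂ _+_ (weight-replicate f (flow s) (flexible s)) (weight-replicate f (h ∸ flow s) (pinned s)))

  chain-lower : ∀ x → weight (λ c → δ (lower c) x) chain ≤ h
  chain-lower x =
    begin
      weight f chain
    ≡⟨ trans (weight-blocks f chainBlock L) (sumTo-cong L (λ s _ → block s)) ⟩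
      sumTo L (λ s → h * δ s x)
    ≤⟨ sift-≤ L (λ _ → h) x ⟩
      h
    ∎
    where
    open ≤-Reasoning
    f : Client → ℕ
    f c = δ (lower c) x
    block : ∀ s → weight f (chainBlock s) ≡ h * δ s x
    block s = trans (chainBlock-weight f s)
                    (trans (sym (*-distribʳ-+ (δ s x) (flow s) (h ∸ flow s)))
                           (cong (_* δ s x) (m+[n∸m]≡n (flow≤h s))))

  chain-upper : ∀ x → weight (λ c → δ (upper c) x) chain ≤ (h ∸ flow x) + inflow x
  chain-upper x =
    begin
      weight f chain
    ≡⟨ trans (weight-blocks f chainBlock L) (sumTo-cong L (λ s _ → block s)) ⟩
      sumTo L (λ s → flow s * δ (suc s) x + (h ∸ flow s) * δ s x)
    ≡⟨ trans (sumTo-+ L (λ s → flow s * δ (suc s) x) (λ s → (h ∸ flow s) * δ s x))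
             (+-comm (sumTo L (λ s → flow s * δ (suc s) x)) _) ⟩
      sumTo L (λ s → (h ∸ flow s) * δ s x) + sumTo L (λ s → flow s * δ (suc s) x)
    ≤⟨ +-mono-≤ (sift-≤ L (λ s → h ∸ flow s) x) (arriving x) ⟩
      (h ∸ flow x) + inflow x
    ∎
    where
    open ≤-Reasoning
    f : Client → ℕ
    f c = δ (upper c) x
    block : ∀ s → weight f (chainBlock s) ≡ flow s * δ (suc s) x + (h ∸ flow s) * δ s x
    block s = chainBlock-weight f s
    arriving : ∀ x → sumTo L (λ s → flow s * δ (suc s) x) ≤ inflow x
    arriving zero    = ≤-reflexive (sumTo-vanish L (λ s → *-zeroʳ (flow s)))
    arriving (suc y) = sift-≤ L flow y

  -- Rounds consist of pinned clients, which every selection π of a server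
  -- (lower or upper) leaves in place; a round adds two clients per server.
  module PinnedCount (π : Client → ℕ) (π-pinned : ∀ s → π (pinned s) ≡ s) (x : ℕ) where
    f : Client → ℕ
    f c = δ (π c) x

    pairs : ∀ n → weight f (blocks twoAt n) ≡ sumTo n (λ s → 2 * δ s x)
    pairs n = trans (weight-blocks f twoAt n)
                    (sumTo-cong n (λ s _ → cong (λ y → δ y x + (δ y x + 0)) (π-pinned s)))

    pairs-≤ : ∀ n → weight f (blocks twoAt n) ≤ 2
    pairs-≤ n = ≤-trans (≤-reflexive (pairs n)) (sift-≤ n (λ _ → 2) x)

    pairs-beyond : ∀ n → n ≤ x → weight f (blocks twoAt n) ≡ 0
    pairs-beyond n n≤x = trans (pairs n) (sift-beyond n (λ _ → 2) x n≤x)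

    rounds-≤ : ∀ k → weight f (rounds k) ≤ k + k
    rounds-≤ zero    = z≤n
    rounds-≤ (suc k) =
      ≤-trans (≤-reflexive (weight-++ f (rounds k) round))
              (≤-trans (+-mono-≤ (rounds-≤ k) (pairs-≤ L))
                       (≤-reflexive (trans (+-assoc k k 2) (trans (cong (k +_) (+-comm k 2)) (+-suc k (suc k))))))

  left-loads : ∀ k rest → clients ≡ (chain ++ rounds k) ++ rest → ∀ s → load leftMode (time k) s ≤ level k
  left-loads k rest split s =
    begin
      load leftMode (time k) s
    ≡⟨ mode-load lower lower-bound (chain ++ rounds k) rest split s ⟩
      weight f (chain ++ rounds k)
    ≡⟨ weight-++ f chain (rounds k) ⟩
      weight f chain + weight f (rounds k)
    ≤⟨ +-mono-≤ (chain-lower (toℕ s)) (P.rounds-≤ k) ⟩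
      h + (k + k)
    ∎
    where
    open ≤-Reasoning
    module P = PinnedCount lower (λ _ → refl) (toℕ s)
    f : Client → ℕ
    f = P.f

  right-loads : ∀ k rest → clients ≡ ((chain ++ rounds k) ++ leftHalf) ++ rest → ∀ s →
                load rightMode (mid k) s ≤ suc (level k)
  right-loads k rest split s =
    begin
      load rightMode (mid k) s
    ≡⟨ mode-load upper upper-bound ((chain ++ rounds k) ++ leftHalf) rest split s ⟩
      weight f ((chain ++ rounds k) ++ leftHalf)
    ≡⟨ trans (weight-++ f (chain ++ rounds k) leftHalf) (cong (_+ weight f leftHalf) (weight-++ f chain (rounds k))) ⟩
      weight f chain + weight f (rounds k) + weight f leftHalf
    ≤⟨ by-half (toℕ s <? h) ⟩
      suc (h + (k + k))
    ∎
    where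
    open ≤-Reasoning
    x : ℕ
    x = toℕ s
    module P = PinnedCount upper (λ _ → refl) x
    f : Client → ℕ
    f = P.f
    by-half : Dec (x < h) → weight f chain + weight f (rounds k) + weight f leftHalf ≤ suc (h + (k + k))
    by-half (yes x<h) =
      begin
        weight f chain + weight f (rounds k) + weight f leftHalf
      ≤⟨ +-mono-≤ (+-monoˡ-≤ (weight f (rounds k)) (chain-upper x)) (P.pairs-≤ h) ⟩
        (h ∸ flow x) + inflow x + weight f (rounds k) + 2
      ≤⟨ +-monoˡ-≤ 2 (+-monoʳ-≤ ((h ∸ flow x) + inflow x) (P.rounds-≤ k)) ⟩
        (h ∸ flow x) + inflow x + (k + k) + 2
      ≡⟨ +-comm _ 2 ⟩
        suc (suc ((h ∸ flow x) + inflow x) + (k + k))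
      ≤⟨ s≤s (+-monoˡ-≤ (k + k) (tent-left x x<h)) ⟩
        suc (h + (k + k))
      ∎
    by-half (no x≮h) =
      begin
        weight f chain + weight f (rounds k) + weight f leftHalf
      ≡⟨ trans (cong (weight f chain + weight f (rounds k) +_) (P.pairs-beyond h (≮⇒≥ x≮h))) (+-identityʳ _) ⟩
        weight f chain + weight f (rounds k)
      ≤⟨ +-mono-≤ (≤-trans (chain-upper x) (tent-right x (≮⇒≥ x≮h) (toℕ<n s))) (P.rounds-≤ k) ⟩
        suc h + (k + k)
      ∎

  block-run : ∀ (𝒜 : AssignmentSeq N L) → (∀ t → t ≤ N → ValidAt G t (𝒜 t)) →
    ∀ pre ys rest → clients ≡ pre ++ (ys ++ rest) → All Pinned ys →
    let t₀    = length pre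
        n     = length ys
        moves = sumTo n (λ r → changesAt 𝒜 (t₀ + r))
    in potential (𝒜 (t₀ + n)) (t₀ + n) ≤ potential (𝒜 t₀) t₀ + (weight lower ys + moves)
       × potential (𝒜 t₀) t₀ + weight lower ys ≤ potential (𝒜 (t₀ + n)) (t₀ + n) + moves
  block-run 𝒜 valid pre ys rest split pins =
    subst (λ w → Φ (t₀ + n) ≤ Φ t₀ + (w + moves) × Φ t₀ + w ≤ Φ (t₀ + n) + moves) servers
          (pinned-run 𝒜 valid t₀ n run≤N pinned-block)
    where
    t₀ n moves : ℕ
    t₀ = length pre
    n  = length ys
    moves = sumTo n (λ r → changesAt 𝒜 (t₀ + r))
    Φ : ℕ → ℕ
    Φ t = potential (𝒜 t) t
    at : ∀ r → client (length pre + r) ≡ nth (ys ++ rest) r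
    at r = trans (cong (λ cs → nth cs (length pre + r)) split) (nth-++ pre (ys ++ rest) r)
    pinned-block : ∀ r → r < length ys → Pinned (client (length pre + r))
    pinned-block r r<n = subst Pinned (sym (trans (at r) (nth-++-< ys rest r r<n))) (nth-All ys pins r r<n)
    servers : sumTo (length ys) (λ r → lower (client (length pre + r))) ≡ weight lower ys
    servers = trans (sumTo-cong (length ys) (λ r _ → cong lower (at r))) (weight-prefix lower ys rest)
    run≤N : length pre + length ys ≤ N
    run≤N = subst (_≤ N) (length-++ pre) (prefix-bound (pre ++ ys) rest (trans split (sym (++-assoc pre ys rest))))

  S Sˡ Sʳ : ℕ
  S  = sumTo L (λ s → s)
  Sˡ = sumTo h (λ s → s)
  Sʳ = sumTo h (h +_)

  S-halves : S ≡ Sˡ + Sʳ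
  S-halves = sumTo-split h h (λ s → s)

  Sʳ-excess : Sʳ ≡ h * h + Sˡ
  Sʳ-excess = trans (sumTo-+ h (λ _ → h) (λ s → s)) (cong (_+ Sˡ) (sumTo-const h h))

  pair-servers : ∀ g n → weight lower (blocks (twoAt ∘ g) n) ≡ sumTo n g + sumTo n g
  pair-servers g n = trans (weight-blocks lower (twoAt ∘ g) n)
                           (trans (sumTo-cong n (λ j _ → cong (g j +_) (+-identityʳ (g j)))) (sumTo-+ n g g))

  all-pinned : ∀ g n → All Pinned (blocks (twoAt ∘ g) n)
  all-pinned g n = All-blocks (twoAt ∘ g) n (λ _ _ → _ ∷ _ ∷ [])

  level-suc : ∀ k → level (suc k) ≡ suc (suc (level k))
  level-suc k = trans (cong (h +_) (cong suc (+-suc k k)))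
                      (trans (+-suc h (suc (k + k))) (cong suc (+-suc h (k + k))))

  round-split : ∀ k → k < q →
    clients ≡ ((chain ++ rounds k) ++ leftHalf) ++ (rightHalf ++ rounds (q ∸ suc k))
  round-split k k<q = trans (after-rounds (suc k) k<q)
    (trans (cong (_++ rounds (q ∸ suc k)) (round-prefix k)) (++-assoc _ rightHalf (rounds (q ∸ suc k))))

  time+left : ∀ k → time k + length leftHalf ≡ mid k
  time+left k = sym (length-++ (chain ++ rounds k))

  mid+right : ∀ k → mid k + length rightHalf ≡ time (suc k)
  mid+right k = trans (sym (length-++ ((chain ++ rounds k) ++ leftHalf))) (cong length (sym (round-prefix k)))

  module LowerBound (𝒜 : AssignmentSeq N L) (optimal : MaintainsOptimal G 𝒜) where

    valid : ∀ t → t ≤ N → ValidAt G t (𝒜 t)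
    valid t t≤N = proj₁ (optimal t t≤N)

    Φ : ℕ → ℕ
    Φ t = potential (𝒜 t) t

    -- At the tight instants the optimal assignment is perfectly balanced,
    -- which determines its potential.
    Φ-rounds : ∀ k → k ≤ q → Φ (time k) ≡ level k * (Sˡ + Sʳ)
    Φ-rounds k k≤q =
      trans (balanced-potential G (𝒜 (time k)) leftMode (time k) (level k) t≤N (time-level k)
               (mode-valid lower lower-bound adjacent-lower (time k)) (left-loads k _ split) (optimal (time k) t≤N))
            (cong (level k *_) S-halves)
      where
      split : clients ≡ (chain ++ rounds k) ++ rounds (q ∸ k)
      split = after-rounds k k≤q
      t≤N : time k ≤ N
      t≤N = prefix-bound (chain ++ rounds k) _ split

    Φ-mid : ∀ k → k < q → Φ (mid k) ≡ suc (level k) * (Sˡ + Sʳ)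
    Φ-mid k k<q =
      trans (balanced-potential G (𝒜 (mid k)) rightMode (mid k) (suc (level k)) t≤N (mid-level k)
               (mode-valid upper upper-bound adjacent-upper (mid k)) (right-loads k _ (round-split k k<q))
               (optimal (mid k) t≤N))
            (cong (suc (level k) *_) S-halves)
      where
      t≤N : mid k ≤ N
      t≤N = prefix-bound ((chain ++ rounds k) ++ leftHalf) _ (round-split k k<q)

    leftMoves rightMoves : ℕ → ℕ
    leftMoves  k = sumTo (length leftHalf) (λ r → changesAt 𝒜 (time k + r))
    rightMoves k = sumTo (length rightHalf) (λ r → changesAt 𝒜 (mid k + r))

    -- Over either half the potential rises
    -- by exactly S = Sˡ + Sʳ, but the new clients contribute 2Sˡ = S - h² (left half)
    -- resp. 2Sʳ = S + h² (right half); the difference h² must come from moves of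
    -- present clients, each worth one.
    left-half : ∀ k → k < q → h * h ≤ leftMoves k
    left-half k k<q = first-half-moves (level k) Sˡ Sʳ (h * h) (leftMoves k) Sʳ-excess
      (subst₂ _≤_ (trans (cong Φ (time+left k)) (Φ-mid k k<q))
                  (cong₂ (λ a b → a + (b + leftMoves k)) (Φ-rounds k (<⇒≤ k<q)) (pair-servers (λ s → s) h))
                  (proj₁ (block-run 𝒜 valid (chain ++ rounds k) leftHalf _ split (all-pinned (λ s → s) h))))
      where
      split : clients ≡ (chain ++ rounds k) ++ (leftHalf ++ (rightHalf ++ rounds (q ∸ suc k)))
      split = trans (round-split k k<q) (++-assoc (chain ++ rounds k) leftHalf _)

    right-half : ∀ k → k < q → h * h ≤ rightMoves k
    right-half k k<q = second-half-moves (level k) Sˡ Sʳ (h * h) (rightMoves k) Sʳ-excess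
      (subst₂ _≤_ (cong₂ _+_ (Φ-mid k k<q) (pair-servers (h +_) h))
                  (cong (_+ rightMoves k) (trans (cong Φ (mid+right k))
                                                 (trans (Φ-rounds (suc k) k<q) (cong (_* (Sˡ + Sʳ)) (level-suc k)))))
                  (proj₂ (block-run 𝒜 valid ((chain ++ rounds k) ++ leftHalf) rightHalf _ (round-split k k<q)
                                    (all-pinned (h +_) h))))

    round-changes : ∀ k → k < q → changesUpTo 𝒜 (time k) + (h * h + h * h) ≤ changesUpTo 𝒜 (time (suc k))
    round-changes k k<q =
      begin
        changesUpTo 𝒜 (time k) + (h * h + h * h)
      ≤⟨ +-monoʳ-≤ (changesUpTo 𝒜 (time k)) (+-mono-≤ (left-half k k<q) (right-half k k<q)) ⟩
        changesUpTo 𝒜 (time k) + (leftMoves k + rightMoves k)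
      ≡⟨ sym (+-assoc (changesUpTo 𝒜 (time k)) (leftMoves k) (rightMoves k)) ⟩
        changesUpTo 𝒜 (time k) + leftMoves k + rightMoves k
      ≡⟨ cong (_+ rightMoves k) (sym (changes-window 𝒜 (time k) (length leftHalf))) ⟩
        changesUpTo 𝒜 (time k + length leftHalf) + rightMoves k
      ≡⟨ cong (λ t → changesUpTo 𝒜 t + rightMoves k) (time+left k) ⟩
        changesUpTo 𝒜 (mid k) + rightMoves k
      ≡⟨ sym (changes-window 𝒜 (mid k) (length rightHalf)) ⟩
        changesUpTo 𝒜 (mid k + length rightHalf)
      ≡⟨ cong (changesUpTo 𝒜) (mid+right k) ⟩
        changesUpTo 𝒜 (time (suc k))
      ∎
      where open ≤-Reasoning

    changes-after : ∀ k → k ≤ q → k * (h * h + h * h) ≤ changesUpTo 𝒜 (time k)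
    changes-after zero    _   = z≤n
    changes-after (suc k) k<q = ≤-trans (≤-reflexive (+-comm (h * h + h * h) _))
                                       (≤-trans (+-monoˡ-≤ _ (changes-after k (<⇒≤ k<q))) (round-changes k k<q))

    total : q * (h * h + h * h) ≤ totalChanges 𝒜
    total = subst (λ t → q * (h * h + h * h) ≤ changesUpTo 𝒜 t) length-clients (changes-after q ≤-refl)

  -- At the end the optimum is L: the left mode attains it and, L * L clients
  -- being on L servers, no assignment does better.
  optimum : OptIs G N L
  optimum = (leftMode , mode-valid lower lower-bound adjacent-lower N , ≤-antisym leftMode≤L (at-least leftMode)) ,
            (λ B _ → at-least B)
    where
    leftMode≤L : maxLoad leftMode N ≤ L
    leftMode≤L = maxLoad≤ leftMode N L (subst (λ t → ∀ s → load leftMode t s ≤ L) length-clients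
                                              (left-loads q [] (sym (++-identityʳ clients))))
    at-least : ∀ B → L ≤ maxLoad B N
    at-least B = square-≤ L (maxLoad B N) (clients≤L*maxLoad B N ≤-refl)

  many-changes : ∀ (𝒜 : AssignmentSeq N L) → MaintainsOptimal G 𝒜 → L ^ 3 ≤ 8 * totalChanges 𝒜
  many-changes 𝒜 optimal = ≤-trans (≤-reflexive (arith q)) (*-monoʳ-≤ 8 (LowerBound.total 𝒜 optimal))
    where
    arith : ∀ q → let L = (q + q) + (q + q) in L * (L * (L * 1)) ≡ 8 * (q * ((q + q) * (q + q) + (q + q) * (q + q)))
    arith = solve-∀

HardInstance : ℕ → Set
HardInstance L = Σ (BipGraph (L * L) L) (λ G →
  OptIs G (L * L) L × (∀ (𝒜 : AssignmentSeq (L * L) L) → MaintainsOptimal G 𝒜 → L ^ 3 ≤ 8 * totalChanges 𝒜))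

hard-instance : ∀ L → 4 ∣ L → HardInstance L
hard-instance L (divides q L≡q*4) =
  subst HardInstance (trans (arith q) (sym L≡q*4)) (G , optimum , many-changes)
  where
  open Construction q
  arith : ∀ q → (q + q) + (q + q) ≡ q * 4
  arith = solve-∀

lemma34 : Σ ℕ (λ c → 0 < c × Σ ℕ (λ L₀ → ∀ (L : ℕ) → 0 < L → 4 ∣ L → L₀ ≤ L →
              Σ (BipGraph (L * L) L) (λ G →
                OptIs G (L * L) L
                × (∀ (𝒜 : AssignmentSeq (L * L) L) → MaintainsOptimal G 𝒜 →
                     L ^ 3 ≤ c * totalChanges 𝒜))))
lemma34 = 8 , z<s , 0 , λ L _ 4∣L _ → hard-instance L 4∣L
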